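{- Let $K\ge1$, $m=2^K-1$ and $B=2^{2^K}$. The factor complexity of the infinite word $a_m(0)a_m(1)\cdots$ satisfies $p_{a_m}(n)=2n$ for $1\le n\le B+1$, and for every $j\ge1$: \[ p_{a_m}(n)=4n-2(B^j-B^{j-1}+2)\quad\text{for } B^j+2\le n\le 2B^j-B^{j-1}+1, \] \[ p_{a_m}(n)=2n+2(B^j-1)\quad\text{for } 2B^j-B^{j-1}+2\le n\le B^{j+1}+1. \] (Thus the phase lengths at level $j$ are $B^{j-1}(B-1)$ for the first range and $B^{j-1}(B-1)^2$ for the second.)
   Context: For $n\ge0$ write $b_p(n)=\lfloor n/2^p\rfloor\bmod 2$; $\oplus$ is XOR and $\&$ is bitwise AND. For $m\ge0$, $a_m(n)=\bigoplus_{p\ge0,\ p\,\&\,m=0} b_p(n)$. For an infinite word $w$, $p_w(n)$ denotes the number of distinct factors (contiguous finite subwords) of $w$ of length $n$. -}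

module Defs where

open import Data.Nat using (ℕ; zero; suc; _+_; _*_; _^_; _%_; _/_; _≡ᵇ_)
open import Data.Bool using (Bool; true; false; _∧_; not; _xor_; if_then_else_)
open import Data.List using (List; map; upTo; foldr; length)
open import Data.Nat.Properties using (m^n≢0)
open import Data.List.Relation.Unary.Unique.Propositional using (Unique)
open import Data.List.Membership.Propositional using (_∈_)
open import Data.Product using (_×_; ∃)
open import Relation.Binary.PropositionalEquality using (_≡_)

bit : ℕ → ℕ → Bool
bit p n = ((n / (2 ^ p)) {{m^n≢0 2 p}}) % 2 ≡ᵇ 1

-- p & m = 0  (bits of p above position p are all 0, since 2^q > p for q > p)
andIsZero : ℕ → ℕ → Bool
andIsZero p m = foldr _∧_ true (map (λ q → not (bit q p ∧ bit q m)) (upTo (suc p)))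

-- a_m(n) = XOR of b_p(n) over p with p & m = 0; b_p(n) = 0 for p > n,
-- so the (formally infinite) XOR reduces to p ≤ n.
a : ℕ → ℕ → Bool
a m n = foldr _xor_ false
          (map (λ p → if andIsZero p m then bit p n else false) (upTo (suc n)))

factorAt : (ℕ → Bool) → ℕ → ℕ → List Bool
factorAt w i n = map (λ k → w (i + k)) (upTo n)

Complexity : (ℕ → Bool) → ℕ → ℕ → Set
Complexity w n c =
  ∃ λ (L : List (List Bool)) →
    Unique L × length L ≡ c ×
    (∀ u → u ∈ L → ∃ λ i → factorAt w i n ≡ u) ×
    (∀ i → factorAt w i n ∈ L)

-- For m = 2 ^ K ∸ 1 the condition p & m = 0 says that 2 ^ K divides p, so a_m(n) is the XOR of the
-- binary digits of n at the multiples of 2 ^ K.  Splitting off the lowest 2 ^ K digits gives, with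
-- B = 2 ^ 2 ^ K, the recursion a_m(B q + r) = a_m(q) ⊕ (r mod 2) for r < B: the word w = a_m is the
-- fixed point of the B-uniform morphism 0 ↦ (01)^(B/2), 1 ↦ (10)^(B/2).
--
-- Let y(p) = [w(p) = w(p + 1)].  Then y(B q + c) = 0 for c < B − 1 and y(B q + B − 1) = ¬ y(q).  A window
-- of y of length B s + t starting at phase r (mod B) meets s block ends if r < B − t and s + 1 otherwise,
-- and reading it at its block ends yields the window of y at q of that length, negated.  This identifies
-- the windows containing a 1 with pairs (phase, window of length s or s + 1 containing a 0); since y has no
-- two consecutive 1s, for s ≥ 2 these are all windows, so p_y(B s + t) = (B − t) p_y(s) + t p_y(s + 1).
-- Hence p_y is affine with slope 2 on [B^j, 2 B^j − B^(j−1)] and slope 1 on [2 B^j − B^(j−1), B^(j+1)],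
-- each level following from the previous one.  Finally w is closed under complement and a factor of w is
-- determined by its first letter and its y-window, so p_w(k + 1) = 2 p_y(k).
module Submission where

open import Defs
open import Algebra.Bundles using (CommutativeRing)
open import Algebra.Structures using (IsMonoid)
open import Data.Bool using (Bool; true; false; not; _∧_; _xor_; if_then_else_; _≟_)
open import Data.Bool.Properties
  using ( ∧-isMonoid; ∧-identityʳ; ∧-zeroʳ; xor-∧-commutativeRing; xor-comm; not-involutive; not-injective
        ; not-¬; ¬-not; not-distribˡ-xor; xor-annihilates-not; if-eta)
open import Data.Empty using (⊥; ⊥-elim)
open import Data.List using (List; []; _∷_; _++_; map; foldr; applyUpTo; length)
open import Data.List.Membership.Propositional using (_∈_)
open import Data.List.Membership.Propositional.Properties using (∈-map⁺; ∈-map⁻; ∈-++⁺ˡ; ∈-++⁺ʳ; ∈-++⁻)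
open import Data.List.Properties using (map-upTo; length-++; length-map; ∷-injective)
open import Data.List.Relation.Unary.All as All using (All; []; _∷_)
import Data.List.Relation.Unary.All.Properties as All
open import Data.List.Relation.Unary.AllPairs as AllPairs using (AllPairs; []; _∷_)
import Data.List.Relation.Unary.AllPairs.Properties as AllPairs
open import Data.List.Relation.Unary.Any using (here; there)
open import Data.Nat hiding (_≟_)
open import Data.Nat.DivMod
open import Data.Nat.Divisibility using (m∣m*n)
open import Data.Nat.Properties hiding (_≟_)
open import Data.Nat.Solver using (module +-*-Solver)
open import Data.Product using (_×_; _,_; ∃; ∃₂; proj₁; proj₂; map₁; map₂)
open import Data.Sum using (_⊎_; inj₁; inj₂)
open import Data.Unit using (⊤; tt)
open import Function using (_∘_; case_of_)
open import Relation.Binary.PropositionalEquality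
open import Relation.Nullary using (¬_; yes; no; contradiction)

open +-*-Solver using (solve; _:+_; _:*_; _:=_; con)
open ≡-Reasoning

module PrefixFold {A : Set} {_∙_ : A → A → A} {ε : A} (isMonoid : IsMonoid _≡_ _∙_ ε) where

  open IsMonoid isMonoid using (assoc; identityˡ; identityʳ)

  fold : (ℕ → A) → ℕ → A
  fold f n = foldr _∙_ ε (applyUpTo f n)

  fold-cong : ∀ {f g} n → (∀ {i} → i < n → f i ≡ g i) → fold f n ≡ fold g n
  fold-cong zero    f≡g = refl
  fold-cong (suc n) f≡g = cong₂ _∙_ (f≡g z<s) (fold-cong n (f≡g ∘ s<s))

  fold-ε : ∀ {f} n → (∀ {i} → i < n → f i ≡ ε) → fold f n ≡ ε
  fold-ε zero    f≡ε = refl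
  fold-ε (suc n) f≡ε = trans (cong₂ _∙_ (f≡ε z<s) (fold-ε n (f≡ε ∘ s<s))) (identityˡ ε)

  fold-head : ∀ {f} n → 0 < n → (∀ {i} → 0 < i → i < n → f i ≡ ε) → fold f n ≡ f 0
  fold-head (suc n) _ f≡ε = trans (cong (_ ∙_) (fold-ε n (f≡ε z<s ∘ s<s))) (identityʳ _)

  fold-+ : ∀ f m n → fold f (m + n) ≡ fold f m ∙ fold (λ i → f (m + i)) n
  fold-+ f zero    n = sym (identityˡ _)
  fold-+ f (suc m) n = trans (cong (f 0 ∙_) (fold-+ (f ∘ suc) m n)) (sym (assoc _ _ _))

  fold-extend : ∀ f {m n} → m ≤ n → (∀ {i} → m ≤ i → f i ≡ ε) → fold f n ≡ fold f m
  fold-extend f {m} m≤n f≡ε with m≤n⇒∃[o]m+o≡n m≤n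
  ... | d , refl = begin
    fold f (m + d)                      ≡⟨ fold-+ f m d ⟩
    fold f m ∙ fold (λ i → f (m + i)) d ≡⟨ cong (_ ∙_) (fold-ε d (λ _ → f≡ε (m≤m+n m _))) ⟩
    fold f m ∙ ε                        ≡⟨ identityʳ _ ⟩
    fold f m                            ∎

open PrefixFold ∧-isMonoid
  using () renaming (fold to ⋀; fold-cong to ⋀-cong; fold-ε to ⋀-true; fold-extend to ⋀-extend)
open PrefixFold (CommutativeRing.+-isMonoid xor-∧-commutativeRing)
  using () renaming (fold to ⨁; fold-cong to ⨁-cong; fold-head to ⨁-head; fold-+ to ⨁-+; fold-extend to ⨁-extend)

applyUpTo-cong : ∀ {A : Set} {f g : ℕ → A} n → (∀ {i} → i < n → f i ≡ g i) →
                 applyUpTo f n ≡ applyUpTo g n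
applyUpTo-cong zero    f≡g = refl
applyUpTo-cong (suc n) f≡g = cong₂ _∷_ (f≡g z<s) (applyUpTo-cong n (f≡g ∘ s<s))

applyUpTo-injective : ∀ {A : Set} {f g : ℕ → A} n → applyUpTo f n ≡ applyUpTo g n →
                      ∀ {i} → i < n → f i ≡ g i
applyUpTo-injective (suc n) eq {zero}  _         = proj₁ (∷-injective eq)
applyUpTo-injective (suc n) eq {suc i} (s<s i<n) = applyUpTo-injective n (proj₂ (∷-injective eq)) i<n

AllPairs-¬-unique : ∀ {A : Set} {R : A → A → Set} → (∀ {a b} → R a b → R b a) →
                    ∀ {S a b} → AllPairs (λ a b → ¬ R a b) S → a ∈ S → b ∈ S → R a b → a ≡ b
AllPairs-¬-unique sym-R (_  ∷ _)   (here refl) (here refl) _   = refl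
AllPairs-¬-unique sym-R (¬R ∷ _)   (here refl) (there b∈)  Rab = contradiction Rab (All.lookup ¬R b∈)
AllPairs-¬-unique sym-R (¬R ∷ _)   (there a∈)  (here refl) Rab = contradiction (sym-R Rab) (All.lookup ¬R a∈)
AllPairs-¬-unique sym-R (_  ∷ ¬Rs) (there a∈)  (there b∈)  Rab = AllPairs-¬-unique sym-R ¬Rs a∈ b∈ Rab

divMod-view : ∀ n .{{_ : NonZero n}} p → ∃₂ λ q r → r < n × n * q + r ≡ p
divMod-view n p = p / n , p % n , m%n<n p n ,
  trans (cong (_+ p % n) (*-comm n (p / n))) (trans (+-comm _ (p % n)) (sym (m≡m%n+[m/n]*n p n)))

[n*q+r]%n≡r : ∀ n q {r} .{{_ : NonZero n}} → r < n → (n * q + r) % n ≡ r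
[n*q+r]%n≡r n q r<n = trans (%-remove-+ˡ _ (m∣m*n q)) (m<n⇒m%n≡m r<n)

[n*q+r]/n≡q : ∀ n q {r} .{{_ : NonZero n}} → r < n → (n * q + r) / n ≡ q
[n*q+r]/n≡q n q {r} r<n = begin
  (n * q + r) / n   ≡⟨ +-distrib-/ (n * q) r no-carry ⟩
  n * q / n + r / n ≡⟨ cong₂ _+_ (trans (/-congˡ (*-comm n q)) (m*n/n≡m q n)) (m<n⇒m/n≡0 r<n) ⟩
  q + 0             ≡⟨ +-identityʳ q ⟩
  q                 ∎
  where
  nq%n≡0 : n * q % n ≡ 0
  nq%n≡0 = trans (%-congˡ (*-comm n q)) (m*n%n≡0 q n)
  no-carry : n * q % n + r % n < n
  no-carry = subst₂ (λ u v → u + v < n) (sym nq%n≡0) (sym (m<n⇒m%n≡m r<n)) r<n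

remainder-unique : ∀ n .{{_ : NonZero n}} {q q' r r'} → r < n → r' < n →
                   n * q + r ≡ n * q' + r' → r ≡ r'
remainder-unique n {q} {q'} r<n r'<n eq =
  trans (sym ([n*q+r]%n≡r n q r<n)) (trans (%-congˡ eq) ([n*q+r]%n≡r n q' r'<n))

m+2≤n⇒∃[d]n≡1+m+d : ∀ {m n} → m + 2 ≤ n → ∃ λ d → n ≡ suc (m + d)
m+2≤n⇒∃[d]n≡1+m+d {m} m+2≤n
  with m≤n⇒∃[o]m+o≡n (≤-trans (subst (_≤ m + 2) (+-comm m 1) (+-monoʳ-≤ m (n≤1+n 1))) m+2≤n)
... | d , refl = d , refl

1+n≤m+1⇒n≤m : ∀ n {m} → suc n ≤ m + 1 → n ≤ m
1+n≤m+1⇒n≤m n {m} le = ≤-pred (subst (suc n ≤_) (+-comm m 1) le)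

n<m^n : ∀ {m} → 1 < m → ∀ n → n < m ^ n
n<m^n     1<m zero    = z<s
n<m^n {m} 1<m (suc n) = ≤-<-trans (n<m^n 1<m n) (^-monoʳ-< m 1<m (n<1+n n))

*+-suc : ∀ n q → n * q + n ≡ n * suc q
*+-suc n q = trans (+-comm (n * q) n) (sym (*-suc n q))

next-block : ∀ b q → suc (suc b * q + b) ≡ suc b * suc q + 0
next-block b q = trans (sym (+-suc (suc b * q) b)) (trans (*+-suc (suc b) q) (sym (+-identityʳ _)))

-- Binary digits

odd : ℕ → Bool
odd zero    = false
odd (suc n) = not (odd n)

odd-2*+ : ∀ q r → odd (2 * q + r) ≡ odd r
odd-2*+ zero    r = refl
odd-2*+ (suc q) r = begin
  odd (2 * suc q + r)   ≡⟨ cong odd (trans (cong (_+ r) (*-suc 2 q)) (+-assoc 2 (2 * q) r)) ⟩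
  odd (2 + (2 * q + r)) ≡⟨ not-involutive _ ⟩
  odd (2 * q + r)       ≡⟨ odd-2*+ q r ⟩
  odd r                 ∎

odd-2^*+ : ∀ d q r → 0 < d → odd (2 ^ d * q + r) ≡ odd r
odd-2^*+ (suc d) q r _ = trans (cong (λ m → odd (m + r)) (*-assoc 2 (2 ^ d) q)) (odd-2*+ (2 ^ d * q) r)

%2≡ᵇ1 : ∀ n → (n % 2 ≡ᵇ 1) ≡ odd n
%2≡ᵇ1 zero          = refl
%2≡ᵇ1 (suc zero)    = refl
%2≡ᵇ1 (suc (suc n)) = trans (%2≡ᵇ1 n) (sym (not-involutive _))

bit-0 : ∀ n → bit 0 n ≡ odd n
bit-0 n = trans (cong (λ m → m % 2 ≡ᵇ 1) (n/1≡n n)) (%2≡ᵇ1 n)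

bit-+ : ∀ d p n → bit (d + p) n ≡ bit p ((n / 2 ^ d) {{m^n≢0 2 d}})
bit-+ d p n = cong (λ m → m % 2 ≡ᵇ 1)
  (trans (/-congʳ (^-distribˡ-+-* 2 d p)) (sym (m/n/o≡m/[n*o] n (2 ^ d) (2 ^ p))))
  where instance
  _ = m^n≢0 2 d
  _ = m^n≢0 2 p
  _ = m^n≢0 2 (d + p)
  _ = m*n≢0 (2 ^ d) (2 ^ p)

bit-large : ∀ q {n} → n < 2 ^ q → bit q n ≡ false
bit-large q n<2^q = cong (λ m → m % 2 ≡ᵇ 1) (m<n⇒m/n≡0 {{m^n≢0 2 q}} n<2^q)

bit-above : ∀ {q n} → n ≤ q → bit q n ≡ false
bit-above {q} n≤q = bit-large q (<-≤-trans (n<m^n (s<s z<s) _) (^-monoʳ-≤ 2 n≤q))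

2^suc∸1 : ∀ K → 2 ^ suc K ∸ 1 ≡ 2 * (2 ^ K ∸ 1) + 1
2^suc∸1 K with 2 ^ K | m^n>0 2 K
... | suc e | _ = trans (+-suc e (e + 0)) (+-comm 1 (2 * e))

odd-2^∸1 : ∀ d → 0 < d → odd (2 ^ d ∸ 1) ≡ true
odd-2^∸1 (suc e) _ = trans (cong odd (2^suc∸1 e)) (odd-2*+ (2 ^ e ∸ 1) 1)

bit-mask-< : ∀ {q K} → q < K → bit q (2 ^ K ∸ 1) ≡ true
bit-mask-< {zero}  {suc K} _ = trans (bit-0 (2 ^ suc K ∸ 1)) (odd-2^∸1 (suc K) z<s)
bit-mask-< {suc q} {suc K} (s<s q<K) = begin
  bit (suc q) (2 ^ suc K ∸ 1)       ≡⟨ bit-+ 1 q (2 ^ suc K ∸ 1) ⟩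
  bit q ((2 ^ suc K ∸ 1) / 2)       ≡⟨ cong (λ m → bit q (m / 2)) (2^suc∸1 K) ⟩
  bit q ((2 * (2 ^ K ∸ 1) + 1) / 2) ≡⟨ cong (bit q) ([n*q+r]/n≡q 2 (2 ^ K ∸ 1) (s<s z<s)) ⟩
  bit q (2 ^ K ∸ 1)                 ≡⟨ bit-mask-< q<K ⟩
  true                              ∎

bit-mask-≥ : ∀ {q K} → K ≤ q → bit q (2 ^ K ∸ 1) ≡ false
bit-mask-≥ {q} {K} K≤q = bit-large q (<-≤-trans (mask<2^K K) (^-monoʳ-≤ 2 K≤q))
  where
  mask<2^K : ∀ K → 2 ^ K ∸ 1 < 2 ^ K
  mask<2^K K with 2 ^ K | m^n>0 2 K
  ... | suc e | _ = n<1+n e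

lowBitsZero : ℕ → ℕ → Bool
lowBitsZero K p = ⋀ (λ q → not (bit q p)) K

andIsZero-mask : ∀ K p → andIsZero p (2 ^ K ∸ 1) ≡ lowBitsZero K p
andIsZero-mask K p = begin
  andIsZero p mask ≡⟨ cong (foldr _∧_ true) (map-upTo f (suc p)) ⟩
  ⋀ f (suc p)      ≡⟨ ⋀-extend f (m≤m+n (suc p) K) above-p ⟨
  ⋀ f (suc p + K)  ≡⟨ ⋀-extend f (m≤n+m K (suc p)) above-K ⟩
  ⋀ f K            ≡⟨ ⋀-cong K below-K ⟩
  lowBitsZero K p  ∎
  where
  mask = 2 ^ K ∸ 1
  f : ℕ → Bool
  f q = not (bit q p ∧ bit q mask)
  above-p : ∀ {q} → suc p ≤ q → f q ≡ true
  above-p {q} p<q = cong (λ b → not (b ∧ bit q mask)) (bit-above (<⇒≤ p<q))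
  above-K : ∀ {q} → K ≤ q → f q ≡ true
  above-K {q} K≤q = trans (cong (λ b → not (bit q p ∧ b)) (bit-mask-≥ K≤q)) (cong not (∧-zeroʳ _))
  below-K : ∀ {q} → q < K → f q ≡ not (bit q p)
  below-K {q} q<K = trans (cong (λ b → not (bit q p ∧ b)) (bit-mask-< q<K)) (cong not (∧-identityʳ _))

lowBitsZero-2*+ : ∀ K h {r} → r < 2 → lowBitsZero (suc K) (2 * h + r) ≡ not (odd r) ∧ lowBitsZero K h
lowBitsZero-2*+ K h {r} r<2 = cong₂ _∧_
  (cong not (trans (bit-0 (2 * h + r)) (odd-2*+ h r)))
  (⋀-cong K λ {q} _ → cong not (trans (bit-+ 1 q (2 * h + r)) (cong (bit q) ([n*q+r]/n≡q 2 h r<2))))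

lowBitsZero-0 : ∀ K → lowBitsZero K 0 ≡ true
lowBitsZero-0 K = ⋀-true K λ {q} _ → cong not (bit-large q (m^n>0 2 q))

lowBitsZero-< : ∀ K {p} → 0 < p → p < 2 ^ K → lowBitsZero K p ≡ false
lowBitsZero-< zero    (s<s _) (s<s ())
lowBitsZero-< (suc K) {p} 0<p p<2^K with divMod-view 2 p
... | h , 1 , r<2 , refl = lowBitsZero-2*+ K h r<2
... | zero , 0 , _ , refl with () ← 0<p
... | _ , suc (suc _) , s<s (s<s ()) , _
... | h@(suc _) , 0 , r<2 , refl = trans (lowBitsZero-2*+ K h r<2) (lowBitsZero-< K z<s h<2^K)
  where
  h<2^K : h < 2 ^ K
  h<2^K = *-cancelˡ-< 2 h (2 ^ K) (subst (_< 2 ^ suc K) (+-identityʳ (2 * h)) p<2^K)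

lowBitsZero-2^K+ : ∀ K p → lowBitsZero K (2 ^ K + p) ≡ lowBitsZero K p
lowBitsZero-2^K+ zero    p = refl
lowBitsZero-2^K+ (suc K) p with divMod-view 2 p
... | h , r , r<2 , refl = begin
  lowBitsZero (suc K) (2 ^ suc K + (2 * h + r)) ≡⟨ cong (lowBitsZero (suc K)) regroup ⟩
  lowBitsZero (suc K) (2 * (2 ^ K + h) + r)     ≡⟨ lowBitsZero-2*+ K (2 ^ K + h) r<2 ⟩
  not (odd r) ∧ lowBitsZero K (2 ^ K + h)       ≡⟨ cong (not (odd r) ∧_) (lowBitsZero-2^K+ K h) ⟩
  not (odd r) ∧ lowBitsZero K h                 ≡⟨ lowBitsZero-2*+ K h r<2 ⟨
  lowBitsZero (suc K) (2 * h + r)               ∎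
  where
  regroup : 2 ^ suc K + (2 * h + r) ≡ 2 * (2 ^ K + h) + r
  regroup = trans (sym (+-assoc (2 * 2 ^ K) (2 * h) r)) (cong (_+ r) (sym (*-distribˡ-+ 2 (2 ^ K) h)))

digitTerm : ℕ → ℕ → ℕ → Bool
digitTerm K n p = if lowBitsZero K p then bit p n else false

a-fold : ∀ K n {N} → suc n ≤ N → a (2 ^ K ∸ 1) n ≡ ⨁ (digitTerm K n) N
a-fold K n {N} n<N = begin
  a (2 ^ K ∸ 1) n           ≡⟨ cong (foldr _xor_ false) (map-upTo g (suc n)) ⟩
  ⨁ g (suc n)               ≡⟨ ⨁-cong (suc n) (λ {p} _ → cong (if_then bit p n else false) (andIsZero-mask K p)) ⟩
  ⨁ (digitTerm K n) (suc n) ≡⟨ ⨁-extend (digitTerm K n) n<N above-n ⟨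
  ⨁ (digitTerm K n) N       ∎
  where
  g : ℕ → Bool
  g p = if andIsZero p (2 ^ K ∸ 1) then bit p n else false
  above-n : ∀ {p} → suc n ≤ p → digitTerm K n p ≡ false
  above-n {p} n<p = trans (cong (if lowBitsZero K p then_else false) (bit-above (<⇒≤ n<p))) (if-eta _)

a-digits : ∀ K n → a (2 ^ K ∸ 1) n ≡ odd n xor a (2 ^ K ∸ 1) ((n / 2 ^ 2 ^ K) {{m^n≢0 2 (2 ^ K)}})
a-digits K n = begin
  a m n                                                           ≡⟨ a-fold K n (m≤n+m (suc n) D) ⟩
  ⨁ (digitTerm K n) (D + suc n)                                   ≡⟨ ⨁-+ (digitTerm K n) D (suc n) ⟩
  ⨁ (digitTerm K n) D xor ⨁ (λ i → digitTerm K n (D + i)) (suc n) ≡⟨ cong₂ _xor_ lowest higher ⟩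
  odd n xor ⨁ (digitTerm K n') (suc n)                            ≡⟨ cong (odd n xor_) (a-fold K n' n'<1+n) ⟨
  odd n xor a m n'                                                ∎
  where
  instance _ = m^n≢0 2 (2 ^ K)
  m = 2 ^ K ∸ 1
  D = 2 ^ K
  n' = n / 2 ^ D
  n'<1+n : suc n' ≤ suc n
  n'<1+n = s≤s (m/n≤m n (2 ^ D))
  lowest : ⨁ (digitTerm K n) D ≡ odd n
  lowest = trans (⨁-head D (m^n>0 2 K) λ {i} 0<i i<D → cong (if_then bit i n else false) (lowBitsZero-< K 0<i i<D))
                 (trans (cong (if_then bit 0 n else false) (lowBitsZero-0 K)) (bit-0 n))
  higher : ⨁ (λ i → digitTerm K n (D + i)) (suc n) ≡ ⨁ (digitTerm K n') (suc n)
  higher = ⨁-cong (suc n) λ {i} _ → cong₂ (if_then_else false) (lowBitsZero-2^K+ K i) (bit-+ D i n)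

a-morphic : ∀ K q {r} → r < 2 ^ 2 ^ K → a (2 ^ K ∸ 1) (2 ^ 2 ^ K * q + r) ≡ a (2 ^ K ∸ 1) q xor odd r
a-morphic K q {r} r<B = begin
  a m (B * q + r)                           ≡⟨ a-digits K (B * q + r) ⟩
  odd (B * q + r) xor a m ((B * q + r) / B) ≡⟨ cong₂ _xor_ (odd-2^*+ (2 ^ K) q r (m^n>0 2 K))
                                                            (cong (a m) ([n*q+r]/n≡q B q r<B)) ⟩
  odd r xor a m q                           ≡⟨ xor-comm (odd r) (a m q) ⟩
  a m q xor odd r                           ∎
  where
  instance _ = m^n≢0 2 (2 ^ K)
  m = 2 ^ K ∸ 1
  B = 2 ^ 2 ^ K

a-zero : ∀ m → a m 0 ≡ false
a-zero m = refl

module Toeplitz (B₁ : ℕ) (2≤B₁ : 2 ≤ B₁) (y : ℕ → Bool)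
  (y-inner : ∀ q {c} → c < B₁ → y (suc B₁ * q + c) ≡ false)
  (y-last : ∀ q → y (suc B₁ * q + B₁) ≡ not (y q)) where

  B : ℕ
  B = suc B₁

  0<B₁ : 0 < B₁
  0<B₁ = ≤-trans (s≤s z≤n) 2≤B₁

  2<B : 2 < B
  2<B = s≤s 2≤B₁

  inner-or-last : ∀ {c} → c < B → c < B₁ ⊎ c ≡ B₁
  inner-or-last c<B = m≤n⇒m<n∨m≡n (≤-pred c<B)

  block-0 : ∀ x → B * 0 + x ≡ x
  block-0 x = cong (_+ x) (*-zeroʳ B)

  y-0 : y 0 ≡ false
  y-0 = trans (cong y (sym (block-0 0))) (y-inner 0 0<B₁)

  y-B₁ : y B₁ ≡ true
  y-B₁ = trans (cong y (sym (block-0 B₁))) (trans (y-last 0) (cong not y-0))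

  no-true-true : ∀ p → y p ≡ true → y (suc p) ≡ false
  no-true-true p yp with divMod-view B p
  ... | q , c , c<B , refl with inner-or-last c<B
  ...   | inj₁ c<B₁ = contradiction (trans (sym (y-inner q c<B₁)) yp) λ ()
  ...   | inj₂ refl = trans (cong y (next-block B₁ q)) (y-inner (suc q) 0<B₁)

  Agree : ℕ → ℕ → ℕ → Set
  Agree k p p' = ∀ {x} → x < k → y (p + x) ≡ y (p' + x)

  agree-sym : ∀ {k p p'} → Agree k p p' → Agree k p' p
  agree-sym agree x<k = sym (agree x<k)

  agree-trans : ∀ {k p p' p''} → Agree k p p' → Agree k p' p'' → Agree k p p''
  agree-trans agree agree' x<k = trans (agree x<k) (agree' x<k)

  Distinct : ℕ → ℕ → ℕ → Set
  Distinct k p p' = ¬ Agree k p p'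

  Constant : Bool → ℕ → ℕ → Set
  Constant b k p = ∀ {x} → x < k → y (p + x) ≡ b

  Occurs : Bool → ℕ → ℕ → Set
  Occurs b k p = ∃ λ x → x < k × y (p + x) ≡ b

  occurs-or-constant : ∀ b k p → Occurs b k p ⊎ Constant (not b) k p
  occurs-or-constant b zero    p = inj₂ λ ()
  occurs-or-constant b (suc k) p with y (p + 0) ≟ b | occurs-or-constant b k (suc p)
  ... | yes y≡b | _                   = inj₁ (0 , z<s , y≡b)
  ... | no  _   | inj₁ (x , x<k , yx) = inj₁ (suc x , s<s x<k , trans (cong y (+-suc p x)) yx)
  ... | no  y≢b | inj₂ const          =
    inj₂ λ { {zero} _ → ¬-not y≢b ; {suc x} (s<s x<k) → trans (cong y (+-suc p x)) (const x<k) }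

  occurs-constant-⊥ : ∀ {b k p} → Occurs b k p → Constant (not b) k p → ⊥
  occurs-constant-⊥ (x , x<k , yx) const = not-¬ yx (const x<k)

  occurs-false : ∀ {L} q → 2 ≤ L → Occurs false L q
  occurs-false q 2≤L with y (q + 0) in yq
  ... | false = 0 , ≤-trans (s≤s z≤n) 2≤L , yq
  ... | true  = 1 , 2≤L , trans (cong y (+-suc q 0)) (no-true-true (q + 0) yq)

  shift-block : ∀ q {r x i c} → r + x ≡ B * i + c → B * q + r + x ≡ B * (q + i) + c
  shift-block q {r} {x} {i} {c} r+x≡ = begin
    B * q + r + x       ≡⟨ +-assoc (B * q) r x ⟩
    B * q + (r + x)     ≡⟨ cong (B * q +_) r+x≡ ⟩
    B * q + (B * i + c) ≡⟨ +-assoc (B * q) (B * i) c ⟨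
    B * q + B * i + c   ≡⟨ cong (_+ c) (*-distribˡ-+ B q i) ⟨
    B * (q + i) + c     ∎

  inner-or-end : ∀ r x → (∀ q → y (B * q + r + x) ≡ false) ⊎ ∃ λ i → r + x ≡ B * i + B₁
  inner-or-end r x with divMod-view B (r + x)
  ... | i , c , c<B , r+x≡ with inner-or-last c<B
  ...   | inj₁ c<B₁ = inj₁ λ q → trans (cong y (shift-block q (sym r+x≡))) (y-inner (q + i) c<B₁)
  ...   | inj₂ refl = inj₂ (i , sym r+x≡)

  y-at-end : ∀ q {r x i} → r + x ≡ B * i + B₁ → y (B * q + r + x) ≡ not (y (q + i))
  y-at-end q r+x≡ = trans (cong y (shift-block q r+x≡)) (y-last _)

  end-index-< : ∀ {r x k i L} → r + x ≡ B * i + B₁ → x < k → r + k ≤ B * L + B₁ → i < L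
  end-index-< {r} {x} {k} {i} {L} r+x≡ x<k r+k≤ = *-cancelˡ-< B i L
    (+-cancelʳ-< B₁ (B * i) (B * L) (<-≤-trans (subst (_< r + k) r+x≡ (+-monoʳ-< r x<k)) r+k≤))

  lift-agree : ∀ {k L r q q'} → r + k ≤ B * L + B₁ → Agree L q q' → Agree k (B * q + r) (B * q' + r)
  lift-agree {r = r} r+k≤ agree {x} x<k with inner-or-end r x
  ... | inj₁ inner       = trans (inner _) (sym (inner _))
  ... | inj₂ (i , r+x≡) =
    trans (y-at-end _ r+x≡) (trans (cong not (agree (end-index-< r+x≡ x<k r+k≤))) (sym (y-at-end _ r+x≡)))

  lift-constant : ∀ {k L r q} → r + k ≤ B * L + B₁ → Constant true L q → Constant false k (B * q + r)
  lift-constant {r = r} r+k≤ const {x} x<k with inner-or-end r x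
  ... | inj₁ inner       = inner _
  ... | inj₂ (i , r+x≡) = trans (y-at-end _ r+x≡) (cong not (const (end-index-< r+x≡ x<k r+k≤)))

  end-offset : ℕ → ℕ → ℕ
  end-offset r i = B * i + B₁ ∸ r

  +-end-offset : ∀ r i → r < B → r + end-offset r i ≡ B * i + B₁
  +-end-offset r i r<B = m+[n∸m]≡n (≤-trans (≤-pred r<B) (m≤n+m B₁ (B * i)))

  end-offset-< : ∀ {r k L i} → r < B → B * L ≤ r + k → i < L → end-offset r i < k
  end-offset-< {r} {k} {L} {i} r<B BL≤ i<L =
    +-cancelˡ-< r _ k (subst (_< r + k) (sym (+-end-offset r i r<B)) (<-≤-trans end<BL BL≤))
    where
    end<BL : B * i + B₁ < B * L
    end<BL = <-≤-trans (subst (B * i + B₁ <_) (*+-suc B i) (+-monoʳ-< (B * i) (n<1+n B₁))) (*-monoʳ-≤ B i<L)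

  descend-agree : ∀ {k L r q q'} → r < B → B * L ≤ r + k → Agree k (B * q + r) (B * q' + r) → Agree L q q'
  descend-agree {r = r} {q} {q'} r<B BL≤ agree {i} i<L = not-injective (begin
    not (y (q + i))                 ≡⟨ y-at-end q (+-end-offset r i r<B) ⟨
    y (B * q + r + end-offset r i)  ≡⟨ agree (end-offset-< r<B BL≤ i<L) ⟩
    y (B * q' + r + end-offset r i) ≡⟨ y-at-end q' (+-end-offset r i r<B) ⟩
    not (y (q' + i))                ∎)

  lift-occurs : ∀ {k L r q} → r < B → B * L ≤ r + k → Occurs false L q → Occurs true k (B * q + r)
  lift-occurs {r = r} {q} r<B BL≤ (i , i<L , yi) =
    end-offset r i , end-offset-< r<B BL≤ i<L , trans (y-at-end q (+-end-offset r i r<B)) (cong not yi)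

  same-end-offset : ∀ {r r' x i i'} → r < B → r' < B → r + x ≡ B * i + B₁ → r' + x ≡ B * i' + B₁ → r ≡ r'
  same-end-offset {r} {r'} {x} {i} {i'} r<B r'<B r+x≡ r'+x≡ =
    remainder-unique B {i'} {i} r<B r'<B (+-cancelʳ-≡ (x + B₁) _ _ (begin
      B * i' + r + (x + B₁)   ≡⟨ solve 5 (λ b i' r x b₁ → b :* i' :+ r :+ (x :+ b₁) := r :+ x :+ (b :* i' :+ b₁))
                                         refl B i' r x B₁ ⟩
      (r + x) + (B * i' + B₁) ≡⟨ cong₂ _+_ r+x≡ (sym r'+x≡) ⟩
      (B * i + B₁) + (r' + x) ≡⟨ solve 5 (λ b i r' x b₁ → b :* i :+ b₁ :+ (r' :+ x) := b :* i :+ r' :+ (x :+ b₁))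
                                         refl B i r' x B₁ ⟩
      B * i + r' + (x + B₁)   ∎))

  phase-unique : ∀ {k q q' r r'} → r < B → r' < B →
                 Occurs true k (B * q + r) → Agree k (B * q + r) (B * q' + r') → r ≡ r'
  phase-unique {q = q} {q'} {r} {r'} r<B r'<B (x , x<k , yx) agree with inner-or-end r x | inner-or-end r' x
  ... | inj₁ inner      | _                  = contradiction (trans (sym (inner q)) yx) λ ()
  ... | inj₂ _          | inj₁ inner'        =
    contradiction (trans (sym (inner' q')) (trans (sym (agree x<k)) yx)) λ ()
  ... | inj₂ (i , r+x≡) | inj₂ (i' , r'+x≡) = same-end-offset r<B r'<B r+x≡ r'+x≡

  phases-distinct : ∀ {k q q' r r'} → r < B → r' < B → r ≢ r' → Occurs true k (B * q + r) →
                    Distinct k (B * q + r) (B * q' + r')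
  phases-distinct r<B r'<B r≢r' occurs agree = r≢r' (phase-unique r<B r'<B occurs agree)

  -- For r < B, the window [r, r + k) contains exactly the block ends B * i + B₁ with i < L.
  Ends : ℕ → ℕ → ℕ → Set
  Ends k r L = r < B × B * L ≤ r + k × r + k ≤ B * L + B₁

  PhaseRange : ℕ → ℕ → ℕ → ℕ → Set
  PhaseRange k L r₀ n = ∀ {r} → r₀ ≤ r → r < r₀ + n → Ends k r L

  regroup : ∀ r s t → B * s + (r + t) ≡ r + (B * s + t)
  regroup r s t = solve 3 (λ r bs t → bs :+ (r :+ t) := r :+ (bs :+ t)) refl r (B * s) t

  <B⇒<B∸t+t : ∀ {r t} → t < B → r < B → r < B ∸ t + t
  <B⇒<B∸t+t {r} t<B r<B = subst (r <_) (sym (m∸n+n≡m (<⇒≤ t<B))) r<B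

  phases-low : ∀ {s t} → t < B → PhaseRange (B * s + t) s 0 (B ∸ t)
  phases-low {s} {t} t<B {r} _ r<B∸t =
    ≤-trans (s≤s (m≤m+n r t)) r+t<B ,
    ≤-trans (m≤m+n (B * s) t) (m≤n+m _ r) ,
    subst (_≤ B * s + B₁) (regroup r s t) (+-monoʳ-≤ (B * s) (≤-pred r+t<B))
    where
    r+t<B : r + t < B
    r+t<B = subst (r + t <_) (m∸n+n≡m (<⇒≤ t<B)) (+-monoˡ-< t r<B∸t)

  phases-high : ∀ {s t} → t < B → PhaseRange (B * s + t) (suc s) (B ∸ t) t
  phases-high {s} {t} t<B {r} B∸t≤r r<B∸t+t =
    r<B ,
    subst₂ _≤_ (*+-suc B s) (regroup r s t) (+-monoʳ-≤ (B * s) B≤r+t) ,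
    subst₂ _≤_ (regroup r s t) (trans (sym (+-assoc (B * s) B B₁)) (cong (_+ B₁) (*+-suc B s)))
               (+-monoʳ-≤ (B * s) (+-mono-≤ (<⇒≤ r<B) (≤-pred t<B)))
    where
    r<B : r < B
    r<B = subst (r <_) (m∸n+n≡m (<⇒≤ t<B)) r<B∸t+t
    B≤r+t : B ≤ r + t
    B≤r+t = subst (_≤ r + t) (m∸n+n≡m (<⇒≤ t<B)) (+-monoˡ-≤ t B∸t≤r)

  record Representatives (k : ℕ) (P : ℕ → Set) (S : List ℕ) : Set where
    field
      distinct : AllPairs (Distinct k) S
      members  : All P S
      complete : ∀ p → P p → ∃ λ p' → p' ∈ S × Agree k p p'

  atPhases : List ℕ → ℕ → ℕ → List ℕ
  atPhases S r₀ zero    = []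
  atPhases S r₀ (suc n) = map (λ q → B * q + r₀) S ++ atPhases S (suc r₀) n

  length-atPhases : ∀ S r₀ n → length (atPhases S r₀ n) ≡ n * length S
  length-atPhases S r₀ zero    = refl
  length-atPhases S r₀ (suc n) =
    trans (length-++ (map _ S)) (cong₂ _+_ (length-map _ S) (length-atPhases S (suc r₀) n))

  ∈-atPhases⁺ : ∀ {S q} r₀ n {r} → q ∈ S → r₀ ≤ r → r < r₀ + n → B * q + r ∈ atPhases S r₀ n
  ∈-atPhases⁺ r₀ zero    {r} q∈ r₀≤r r<r₀+0 =
    contradiction (subst (r <_) (+-identityʳ r₀) r<r₀+0) (≤⇒≯ r₀≤r)
  ∈-atPhases⁺ r₀ (suc n) {r} q∈ r₀≤r r<r₀+n with m≤n⇒m<n∨m≡n r₀≤r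
  ... | inj₂ refl = ∈-++⁺ˡ (∈-map⁺ _ q∈)
  ... | inj₁ r₀<r = ∈-++⁺ʳ _ (∈-atPhases⁺ (suc r₀) n q∈ r₀<r (subst (r <_) (+-suc r₀ n) r<r₀+n))

  ∈-atPhases⁻ : ∀ {S p} r₀ n → p ∈ atPhases S r₀ n →
                ∃₂ λ q r → q ∈ S × r₀ ≤ r × r < r₀ + n × p ≡ B * q + r
  ∈-atPhases⁻ {S} r₀ (suc n) p∈ with ∈-++⁻ (map (λ q → B * q + r₀) S) p∈
  ... | inj₁ p∈map with ∈-map⁻ _ p∈map
  ...   | q , q∈ , p≡ = q , r₀ , q∈ , ≤-refl , m<m+n r₀ z<s , p≡
  ∈-atPhases⁻ r₀ (suc n) p∈ | inj₂ p∈rest with ∈-atPhases⁻ (suc r₀) n p∈rest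
  ...   | q , r , q∈ , r₀<r , r< , p≡ = q , r , q∈ , <⇒≤ r₀<r , subst (r <_) (sym (+-suc r₀ n)) r< , p≡

  atPhases-occurs : ∀ {k L S} r₀ n → PhaseRange k L r₀ n → All (Occurs false L) S →
                    All (Occurs true k) (atPhases S r₀ n)
  atPhases-occurs r₀ n ends occurs = All.tabulate λ p∈ → case ∈-atPhases⁻ r₀ n p∈ of λ where
    (q , r , q∈ , r₀≤r , r< , refl) →
      let r<B , BL≤ , _ = ends r₀≤r r< in lift-occurs r<B BL≤ (All.lookup occurs q∈)

  atPhases-distinct : ∀ {k L S} r₀ n → PhaseRange k L r₀ n → Representatives L (Occurs false L) S →
                      AllPairs (Distinct k) (atPhases S r₀ n)
  atPhases-distinct r₀ zero    ends R = []
  atPhases-distinct {k} {L} {S} r₀ (suc n) ends R =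
    AllPairs.++⁺ (AllPairs.map⁺ (AllPairs.map (λ d → d ∘ descend-agree r₀<B BL≤) distinct))
                 (atPhases-distinct (suc r₀) n later-ends R)
                 (All.tabulate later-distinct)
    where
    open Representatives R
    r₀<B = proj₁ (ends ≤-refl (m<m+n r₀ z<s))
    BL≤ = proj₁ (proj₂ (ends ≤-refl (m<m+n r₀ z<s)))
    later-ends : PhaseRange k L (suc r₀) n
    later-ends {r} r₀<r r< = ends (<⇒≤ r₀<r) (subst (r <_) (sym (+-suc r₀ n)) r<)
    later-distinct : ∀ {p} → p ∈ map (λ q → B * q + r₀) S → All (Distinct k p) (atPhases S (suc r₀) n)
    later-distinct p∈ with ∈-map⁻ _ p∈
    ... | q , q∈ , refl = All.tabulate λ p'∈ → case ∈-atPhases⁻ (suc r₀) n p'∈ of λ where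
      (q' , r , _ , r₀<r , r< , refl) → phases-distinct r₀<B (proj₁ (later-ends r₀<r r<)) (<⇒≢ r₀<r)
                                                        (lift-occurs r₀<B BL≤ (All.lookup members q∈))

  lift-complete : ∀ {k L r q S} → r + k ≤ B * L + B₁ → Representatives L (Occurs false L) S →
                  Occurs true k (B * q + r) → ∃ λ q' → q' ∈ S × Agree k (B * q + r) (B * q' + r)
  lift-complete {L = L} {q = q} r+k≤ R occurs with occurs-or-constant false L q
  ... | inj₁ occurs-false = map₂ (map₂ (lift-agree r+k≤)) (Representatives.complete R q occurs-false)
  ... | inj₂ const        = ⊥-elim (occurs-constant-⊥ occurs (lift-constant r+k≤ const))

  lifted : ℕ → List ℕ → List ℕ → List ℕ
  lifted t S₁ S₂ = atPhases S₁ 0 (B ∸ t) ++ atPhases S₂ (B ∸ t) t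

  length-lifted : ∀ t S₁ S₂ → length (lifted t S₁ S₂) ≡ (B ∸ t) * length S₁ + t * length S₂
  length-lifted t S₁ S₂ = trans (length-++ (atPhases S₁ 0 (B ∸ t)))
                                (cong₂ _+_ (length-atPhases S₁ 0 (B ∸ t)) (length-atPhases S₂ (B ∸ t) t))

  lifted-distinct : ∀ {s t S₁ S₂} → t < B →
    Representatives s (Occurs false s) S₁ → Representatives (suc s) (Occurs false (suc s)) S₂ →
    AllPairs (Distinct (B * s + t)) (lifted t S₁ S₂)
  lifted-distinct {s} {t} {S₁} {S₂} t<B R₁ R₂ =
    AllPairs.++⁺ (atPhases-distinct 0 (B ∸ t) (phases-low t<B) R₁)
                 (atPhases-distinct (B ∸ t) t (phases-high t<B) R₂)
                 (All.tabulate λ p∈ → All.tabulate λ p'∈ → low-high p∈ p'∈)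
    where
    low-high : ∀ {p p'} → p ∈ atPhases S₁ 0 (B ∸ t) → p' ∈ atPhases S₂ (B ∸ t) t → Distinct (B * s + t) p p'
    low-high p∈ p'∈ with ∈-atPhases⁻ 0 (B ∸ t) p∈ | ∈-atPhases⁻ (B ∸ t) t p'∈
    ... | q , r , q∈ , _ , r<B∸t , refl | q' , r' , _ , B∸t≤r' , r'< , refl =
      let r<B , Bs≤ , _ = phases-low t<B z≤n r<B∸t
      in phases-distinct r<B (proj₁ (phases-high {s} t<B B∸t≤r' r'<)) (<⇒≢ (<-≤-trans r<B∸t B∸t≤r'))
                         (lift-occurs r<B Bs≤ (All.lookup (Representatives.members R₁) q∈))

  lifted-complete : ∀ {s t S₁ S₂} → t < B →
    Representatives s (Occurs false s) S₁ → Representatives (suc s) (Occurs false (suc s)) S₂ →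
    ∀ p → Occurs true (B * s + t) p → ∃ λ p' → p' ∈ lifted t S₁ S₂ × Agree (B * s + t) p p'
  lifted-complete {s} {t} {S₁} {S₂} t<B R₁ R₂ p occurs with divMod-view B p
  ... | q , r , r<B , refl with r <? B ∸ t
  ...   | yes r<B∸t =
    let q' , q'∈ , agree = lift-complete (proj₂ (proj₂ (phases-low t<B z≤n r<B∸t))) R₁ occurs
    in B * q' + r , ∈-++⁺ˡ (∈-atPhases⁺ 0 (B ∸ t) q'∈ z≤n r<B∸t) , agree
  ...   | no  r≮B∸t =
    let q' , q'∈ , agree = lift-complete (proj₂ (proj₂ (phases-high t<B B∸t≤r r<B∸t+t))) R₂ occurs
    in B * q' + r , ∈-++⁺ʳ _ (∈-atPhases⁺ (B ∸ t) t q'∈ B∸t≤r r<B∸t+t) , agree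
    where
    B∸t≤r = ≮⇒≥ r≮B∸t
    r<B∸t+t = <B⇒<B∸t+t t<B r<B

  lift-representatives : ∀ {s t S₁ S₂} → t < B →
    Representatives s (Occurs false s) S₁ → Representatives (suc s) (Occurs false (suc s)) S₂ →
    Representatives (B * s + t) (Occurs true (B * s + t)) (lifted t S₁ S₂)
  lift-representatives {t = t} t<B R₁ R₂ = record
    { distinct = lifted-distinct t<B R₁ R₂
    ; members  = All.++⁺ (atPhases-occurs 0 (B ∸ t) (phases-low t<B) (Representatives.members R₁))
                         (atPhases-occurs (B ∸ t) t (phases-high t<B) (Representatives.members R₂))
    ; complete = lifted-complete t<B R₁ R₂
    }

  occurs-true : ∀ {s t} → 2 ≤ s → t < B → ∀ p → Occurs true (B * s + t) p
  occurs-true {s} {t} 2≤s t<B p with divMod-view B p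
  ... | q , r , r<B , refl with r <? B ∸ t
  ...   | yes r<B∸t = lift-occurs r<B (proj₁ (proj₂ (phases-low t<B z≤n r<B∸t))) (occurs-false q 2≤s)
  ...   | no  r≮B∸t = lift-occurs r<B (proj₁ (proj₂ (phases-high t<B (≮⇒≥ r≮B∸t) (<B⇒<B∸t+t t<B r<B))))
                                  (occurs-false q (m≤n⇒m≤1+n 2≤s))

  -- Counting windows

  WindowCount : ℕ → ℕ → Set
  WindowCount k c = ∃ λ S → Representatives k (λ _ → ⊤) S × length S ≡ c

  restrict : ∀ {k P S} → (∀ p → P p) → Representatives k (λ _ → ⊤) S → Representatives k P S
  restrict everywhere R = record
    { distinct = distinct ; members = All.universal everywhere _ ; complete = λ p _ → complete p tt }
    where open Representatives R

  unrestrict : ∀ {k P S} → (∀ p → P p) → Representatives k P S → Representatives k (λ _ → ⊤) S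
  unrestrict everywhere R = record
    { distinct = distinct ; members = All.universal (λ _ → tt) _ ; complete = λ p _ → complete p (everywhere p) }
    where open Representatives R

  add-constant : ∀ {k z S} → Constant false k z → Representatives k (Occurs true k) S →
                 Representatives k (λ _ → ⊤) (z ∷ S)
  add-constant {k} {z} const R = record
    { distinct = All.tabulate (λ p∈ agree → occurs-constant-⊥ (All.lookup members p∈)
                                              λ {x} x<k → trans (sym (agree x<k)) (const x<k))
                 ∷ distinct
    ; members  = All.universal (λ _ → tt) _
    ; complete = λ p _ → case occurs-or-constant true k p of λ where
        (inj₁ occurs) → map₂ (map₁ there) (complete p occurs)
        (inj₂ const') → z , here refl , λ {x} x<k → trans (const' x<k) (sym (const x<k))
    }
    where open Representatives R

  no-false-representatives : Representatives 0 (Occurs false 0) []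
  no-false-representatives = record { distinct = [] ; members = [] ; complete = λ { _ (_ , () , _) } }

  false-representatives-1 : Representatives 1 (Occurs false 1) (0 ∷ [])
  false-representatives-1 = record
    { distinct = [] ∷ []
    ; members  = (0 , z<s , y-0) ∷ []
    ; complete = λ { p (zero , _ , yp) → 0 , here refl , λ { {zero} _ → trans yp (sym y-0) ; {suc _} (s<s ()) }
                   ; _ (suc _ , s<s () , _) }
    }

  mix : ∀ {t} c d → t ≤ B → (B ∸ t) * c + t * (c + d) ≡ B * c + t * d
  mix {t} c d t≤B = begin
    (B ∸ t) * c + t * (c + d)     ≡⟨ cong ((B ∸ t) * c +_) (*-distribˡ-+ t c d) ⟩
    (B ∸ t) * c + (t * c + t * d) ≡⟨ +-assoc ((B ∸ t) * c) (t * c) (t * d) ⟨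
    (B ∸ t) * c + t * c + t * d   ≡⟨ cong (_+ t * d) (*-distribʳ-+ c (B ∸ t) t) ⟨
    (B ∸ t + t) * c + t * d       ≡⟨ cong (λ b → b * c + t * d) (m∸n+n≡m t≤B) ⟩
    B * c + t * d                 ∎

  count-small : ∀ {t} → t < B → WindowCount t (suc t)
  count-small {t} t<B = subst (λ k → WindowCount k (suc t)) (block-0 t)
    ( B * 0 + 0 ∷ lifted t [] (0 ∷ [])
    , add-constant (lift-constant {L = 0} {r = 0} {q = 0} (+-monoʳ-≤ (B * 0) (≤-pred t<B)) λ ())
                   (lift-representatives t<B no-false-representatives false-representatives-1)
    , cong suc (trans (length-lifted t [] (0 ∷ [])) (cong₂ _+_ (*-zeroʳ (B ∸ t)) (*-identityʳ t)))
    )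

  -- The extra class is the all-false window at B * B₁, whose only block end reads ¬ y B₁.
  count-one : ∀ {t} → t < B → WindowCount (B * 1 + t) (B * 1 + 1 + 2 * t)
  count-one {t} t<B with count-small 2<B
  ... | S₂ , R₂ , length-S₂ =
    ( B * B₁ + 0 ∷ lifted t (0 ∷ []) S₂
    , add-constant (lift-constant {L = 1} {r = 0} {q = B₁} (+-monoʳ-≤ (B * 1) (≤-pred t<B)) y-B₁-window)
                   (lift-representatives t<B false-representatives-1 (restrict (λ q → occurs-false q ≤-refl) R₂))
    , (begin
        suc (length (lifted t (0 ∷ []) S₂)) ≡⟨ cong suc (length-lifted t (0 ∷ []) S₂) ⟩
        suc ((B ∸ t) * 1 + t * length S₂)   ≡⟨ cong (λ c → suc ((B ∸ t) * 1 + t * c)) length-S₂ ⟩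
        suc ((B ∸ t) * 1 + t * (1 + 2))     ≡⟨ cong suc (mix 1 2 (<⇒≤ t<B)) ⟩
        suc (B * 1 + t * 2)                 ≡⟨ solve 2 (λ b t → con 1 :+ (b :+ t :* con 2) := b :+ con 1 :+ con 2 :* t)
                                                       refl (B * 1) t ⟩
        B * 1 + 1 + 2 * t                   ∎)
    )
    where
    y-B₁-window : Constant true 1 B₁
    y-B₁-window {zero}  _         = trans (cong y (+-identityʳ B₁)) y-B₁
    y-B₁-window {suc _} (s<s ())

  count-initial : ∀ {k} → k ≤ B → WindowCount k (suc k)
  count-initial k≤B with m≤n⇒m<n∨m≡n k≤B
  ... | inj₁ k<B  = count-small k<B
  ... | inj₂ refl = subst₂ WindowCount (trans (+-identityʳ _) (*-identityʳ B))
                                       (trans (+-identityʳ _) (trans (cong (_+ 1) (*-identityʳ B)) (+-comm B 1)))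
                                       (count-one z<s)

  count-step : ∀ {s t c₁ c₂} → 2 ≤ s → t < B → WindowCount s c₁ → WindowCount (suc s) c₂ →
               WindowCount (B * s + t) ((B ∸ t) * c₁ + t * c₂)
  count-step {s} {t} 2≤s t<B (S₁ , R₁ , length-S₁) (S₂ , R₂ , length-S₂) =
    ( lifted t S₁ S₂
    , unrestrict (occurs-true 2≤s t<B)
        (lift-representatives t<B (restrict (λ q → occurs-false q 2≤s) R₁)
                                  (restrict (λ q → occurs-false q (m≤n⇒m≤1+n 2≤s)) R₂))
    , trans (length-lifted t S₁ S₂) (cong₂ (λ c₁ c₂ → (B ∸ t) * c₁ + t * c₂) length-S₁ length-S₂)
    )

  count-step-affine : ∀ {s t c α} → 2 ≤ s → t < B → WindowCount s c → WindowCount (suc s) (c + α) →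
                      WindowCount (B * s + t) (B * c + t * α)
  count-step-affine {c = c} {α} 2≤s t<B W W' = subst (WindowCount _) (mix c α (<⇒≤ t<B)) (count-step 2≤s t<B W W')

  record Affine (α c₀ lo hi : ℕ) : Set where
    constructor affine
    field count : ∀ d → lo + d ≤ hi → WindowCount (lo + d) (c₀ + α * d)

  affine-cong : ∀ {α c₀ c₀' lo lo' hi hi'} → c₀ ≡ c₀' → lo ≡ lo' → hi ≡ hi' →
                Affine α c₀ lo hi → Affine α c₀' lo' hi'
  affine-cong refl refl refl A = A

  affine-cons : ∀ {α c₀ lo hi} → WindowCount lo c₀ → Affine α (c₀ + α) (suc lo) hi → Affine α c₀ lo hi
  affine-cons {α} {c₀} {lo} {hi} first (affine rest) = affine λ where
    zero    _       → subst₂ WindowCount (sym (+-identityʳ lo))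
                                         (sym (trans (cong (c₀ +_) (*-zeroʳ α)) (+-identityʳ c₀)))
                                         first
    (suc d) lo+d<hi → subst₂ WindowCount (sym (+-suc lo d))
                                         (trans (+-assoc c₀ α (α * d)) (cong (c₀ +_) (sym (*-suc α d))))
                                         (rest d (subst (_≤ hi) (+-suc lo d) lo+d<hi))

  affine-second : ∀ {α c₀ lo hi} → Affine α c₀ lo hi → lo < hi → ∃ λ c → WindowCount (suc lo) c
  affine-second {α} {c₀} {lo} {hi} (affine A) lo<hi =
    c₀ + α * 1 , subst (λ k → WindowCount k (c₀ + α * 1)) (+-comm lo 1) (A 1 (subst (_≤ hi) (+-comm 1 lo) lo<hi))

  lift-index : ∀ lo e t → B * (lo + e) + t ≡ B * lo + (B * e + t)
  lift-index = solve 4 (λ b l e t → b :* (l :+ e) :+ t := b :* l :+ (b :* e :+ t)) refl B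

  lift-count : ∀ c₀ α e t → B * (c₀ + α * e) + t * α ≡ B * c₀ + α * (B * e + t)
  lift-count = solve 5 (λ b c₀ α e t → b :* (c₀ :+ α :* e) :+ t :* α := b :* c₀ :+ α :* (b :* e :+ t)) refl B

  -- The count at hi + 1 enters the step formula at the right end d = B * (hi ∸ lo), with weight t = 0.
  affine-lift : ∀ {α c₀ lo hi} → 2 ≤ lo → Affine α c₀ lo hi → (∃ λ c → WindowCount (suc hi) c) →
                Affine α (B * c₀) (B * lo) (B * hi)
  affine-lift {α} {c₀} {lo} {hi} 2≤lo (affine A) (_ , next) = affine count
    where
    count : ∀ d → B * lo + d ≤ B * hi → WindowCount (B * lo + d) (B * c₀ + α * d)
    count d Blo+d≤Bhi with divMod-view B d
    ... | e , t , t<B , refl =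
      subst₂ WindowCount (lift-index lo e t) (lift-count c₀ α e t) (from-block (m≤n⇒m<n∨m≡n lo+e≤hi))
      where
      B[lo+e]+t≤Bhi : B * (lo + e) + t ≤ B * hi
      B[lo+e]+t≤Bhi = subst (_≤ B * hi) (sym (lift-index lo e t)) Blo+d≤Bhi
      lo+e≤hi : lo + e ≤ hi
      lo+e≤hi = *-cancelˡ-≤ B (≤-trans (m≤m+n _ t) B[lo+e]+t≤Bhi)
      2≤lo+e : 2 ≤ lo + e
      2≤lo+e = ≤-trans 2≤lo (m≤m+n lo e)
      from-block : lo + e < hi ⊎ lo + e ≡ hi → WindowCount (B * (lo + e) + t) (B * (c₀ + α * e) + t * α)
      from-block (inj₁ lo+e<hi) = count-step-affine 2≤lo+e t<B (A e lo+e≤hi)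
        (subst₂ WindowCount (+-suc lo e)
                (solve 3 (λ c₀ α e → c₀ :+ α :* (con 1 :+ e) := c₀ :+ α :* e :+ α) refl c₀ α e)
                (A (suc e) (subst (_≤ hi) (sym (+-suc lo e)) lo+e<hi)))
      from-block (inj₂ lo+e≡hi) =
        subst (λ t → WindowCount (B * (lo + e) + t) (B * (c₀ + α * e) + t * α)) (sym t≡0)
              (count-step 2≤lo+e z<s (A e lo+e≤hi) (subst (λ h → WindowCount (suc h) _) (sym lo+e≡hi) next))
        where
        t≡0 : t ≡ 0
        t≡0 = n≤0⇒n≡0 (+-cancelˡ-≤ (B * (lo + e)) t 0
          (subst (B * (lo + e) + t ≤_) (trans (cong (B *_) (sym lo+e≡hi)) (sym (+-identityʳ _))) B[lo+e]+t≤Bhi))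

  -- The two affine pieces of level j, for Y = B ^ (j ∸ 1).
  Level : ℕ → Set
  Level Y = Affine 2 (B * Y + Y) (B * Y) (B * Y + B₁ * Y)
          × Affine 1 (B * Y + B₁ * Y + B * Y) (B * Y + B₁ * Y) (B * (B * Y))

  level-1 : Level 1
  level-1 = rising , steady
    where
    rising : Affine 2 (B * 1 + 1) (B * 1) (B * 1 + B₁ * 1)
    rising = affine λ d B+d≤ →
      count-one (s≤s (subst (d ≤_) (*-identityʳ B₁) (+-cancelˡ-≤ (B * 1) d _ B+d≤)))
    initial : Affine 1 3 2 B
    initial = affine λ d 2+d≤B →
      subst (WindowCount (2 + d)) (cong (3 +_) (sym (*-identityˡ d))) (count-initial 2+d≤B)
    first : WindowCount (B * 1 + B₁ * 1) (B * 1 + B₁ * 1 + B * 1)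
    first = subst₂ WindowCount (cong (B * 1 +_) (sym (*-identityʳ B₁)))
                               (solve 1 (λ b₁ → (con 1 :+ b₁) :* con 1 :+ con 1 :+ con 2 :* b₁
                                              := (con 1 :+ b₁) :* con 1 :+ b₁ :* con 1 :+ (con 1 :+ b₁) :* con 1)
                                        refl B₁)
                               (count-one (n<1+n B₁))
    after-B : WindowCount (suc B) (B * 1 + 1 + 2 * 1)
    after-B = subst (λ k → WindowCount k (B * 1 + 1 + 2 * 1)) (trans (cong (_+ 1) (*-identityʳ B)) (+-comm B 1))
                    (count-one (s≤s 0<B₁))
    steady : Affine 1 (B * 1 + B₁ * 1 + B * 1) (B * 1 + B₁ * 1) (B * (B * 1))
    steady = affine-cons first (affine-cong
      (solve 1 (λ b₁ → (con 1 :+ b₁) :* con 3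
                     := (con 1 :+ b₁) :* con 1 :+ b₁ :* con 1 :+ (con 1 :+ b₁) :* con 1 :+ con 1) refl B₁)
      (solve 1 (λ b₁ → (con 1 :+ b₁) :* con 2 := con 1 :+ ((con 1 :+ b₁) :* con 1 :+ b₁ :* con 1)) refl B₁)
      (cong (B *_) (sym (*-identityʳ B)))
      (affine-lift ≤-refl initial (_ , after-B)))

  level-next : ∀ {Y} → 1 ≤ Y → Level Y → Level (B * Y)
  level-next {Y} 1≤Y (rising , steady) = rising' , steady'
    where
    2≤BY : 2 ≤ B * Y
    2≤BY = ≤-trans (<⇒≤ 2<B) (subst (_≤ B * Y) (*-identityʳ B) (*-monoʳ-≤ B 1≤Y))
    Y<BY : Y < B * Y
    Y<BY = subst (_< B * Y) (+-identityʳ Y) (+-monoʳ-< Y (*-mono-≤ 0<B₁ 1≤Y))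
    rising' : Affine 2 (B * (B * Y) + B * Y) (B * (B * Y)) (B * (B * Y) + B₁ * (B * Y))
    rising' = affine-cong
      (solve 2 (λ b y → b :* (b :* y :+ y) := b :* (b :* y) :+ b :* y) refl B Y)
      refl
      (solve 3 (λ b b₁ y → b :* (b :* y :+ b₁ :* y) := b :* (b :* y) :+ b₁ :* (b :* y)) refl B B₁ Y)
      (affine-lift 2≤BY rising (affine-second steady (+-monoʳ-< (B * Y) (*-monoʳ-< B₁ {{>-nonZero 0<B₁}} Y<BY))))
    steady' : Affine 1 (B * (B * Y) + B₁ * (B * Y) + B * (B * Y)) (B * (B * Y) + B₁ * (B * Y)) (B * (B * (B * Y)))
    steady' = affine-cong
      (solve 3 (λ b b₁ y → b :* (b :* y :+ b₁ :* y :+ b :* y) := b :* (b :* y) :+ b₁ :* (b :* y) :+ b :* (b :* y))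
               refl B B₁ Y)
      (solve 3 (λ b b₁ y → b :* (b :* y :+ b₁ :* y) := b :* (b :* y) :+ b₁ :* (b :* y)) refl B B₁ Y)
      refl
      (affine-lift (≤-trans 2≤BY (m≤m+n (B * Y) (B₁ * Y))) steady
        (affine-second rising' (m<m+n (B * (B * Y)) (*-mono-≤ 0<B₁ (*-mono-≤ (z<s {n = B₁}) 1≤Y)))))

  levels : ∀ i → Level (B ^ i)
  levels zero    = level-1
  levels (suc i) = level-next (m^n>0 B i) (levels i)

-- The statement of theorem47 for a word w and base B, abstracted over B so that it can be transported
-- along suc (2 ^ 2 ^ K ∸ 1) ≡ 2 ^ 2 ^ K.
ComplexityFormulas : (ℕ → Bool) → ℕ → Set
ComplexityFormulas w B =
  ((n : ℕ) → 1 ≤ n → n ≤ B + 1 → Complexity w n (2 * n))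
  × ((j : ℕ) → 1 ≤ j →
       ((n : ℕ) → B ^ j + 2 ≤ n → n ≤ 2 * B ^ j ∸ B ^ (j ∸ 1) + 1 →
          Complexity w n (4 * n ∸ 2 * (B ^ j ∸ B ^ (j ∸ 1) + 2)))
     × ((n : ℕ) → 2 * B ^ j ∸ B ^ (j ∸ 1) + 2 ≤ n → n ≤ B ^ (j + 1) + 1 →
          Complexity w n (2 * n + 2 * (B ^ j ∸ 1))))

module MorphicWord (B₁ : ℕ) (2≤B₁ : 2 ≤ B₁) (B₁-odd : odd B₁ ≡ true) (w : ℕ → Bool) (w-0 : w 0 ≡ false)
  (w-morphic : ∀ q {r} → r < suc B₁ → w (suc B₁ * q + r) ≡ w q xor odd r) where

  y : ℕ → Bool
  y p = not (w p xor w (suc p))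

  w-suc : ∀ p → w (suc p) ≡ w p xor not (y p)
  w-suc p with w p | w (suc p)
  ... | false | false = refl
  ... | false | true  = refl
  ... | true  | false = refl
  ... | true  | true  = refl

  y-inner : ∀ q {c} → c < B₁ → y (suc B₁ * q + c) ≡ false
  y-inner q {c} c<B₁ = begin
    not (w (B * q + c) xor w (suc (B * q + c)))     ≡⟨ cong₂ (λ u v → not (u xor v)) w-c w-c+1 ⟩
    not ((w q xor odd c) xor (w q xor not (odd c))) ≡⟨ alternating (w q) (odd c) ⟩
    false                                           ∎
    where
    B = suc B₁
    w-c : w (B * q + c) ≡ w q xor odd c
    w-c = w-morphic q (m<n⇒m<1+n c<B₁)
    w-c+1 : w (suc (B * q + c)) ≡ w q xor not (odd c)
    w-c+1 = trans (cong w (sym (+-suc (B * q) c))) (w-morphic q (s≤s c<B₁))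
    alternating : ∀ u v → not ((u xor v) xor (u xor not v)) ≡ false
    alternating false false = refl
    alternating false true  = refl
    alternating true  false = refl
    alternating true  true  = refl

  y-last : ∀ q → y (suc B₁ * q + B₁) ≡ not (y q)
  y-last q = begin
    not (w (B * q + B₁) xor w (suc (B * q + B₁)))  ≡⟨ cong₂ (λ u v → not (u xor v)) w-last w-next ⟩
    not ((w q xor true) xor (w (suc q) xor false)) ≡⟨ flipped (w q) (w (suc q)) ⟩
    not (y q)                                      ∎
    where
    B = suc B₁
    w-last : w (B * q + B₁) ≡ w q xor true
    w-last = trans (w-morphic q (n<1+n B₁)) (cong (w q xor_) B₁-odd)
    w-next : w (suc (B * q + B₁)) ≡ w (suc q) xor false
    w-next = trans (cong w (next-block B₁ q)) (w-morphic (suc q) z<s)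
    flipped : ∀ u v → not ((u xor true) xor (v xor false)) ≡ not (not (u xor v))
    flipped false false = refl
    flipped false true  = refl
    flipped true  false = refl
    flipped true  true  = refl

  open Toeplitz B₁ 2≤B₁ y y-inner y-last

  w-1 : w 1 ≡ true
  w-1 = trans (cong w (sym (block-0 1))) (trans (w-morphic 0 (s≤s 0<B₁)) (cong (_xor true) w-0))

  w-complement : ∀ e {i} → i < B ^ e → w (B ^ e + i) ≡ not (w i)
  w-complement zero    {zero}  _        = trans w-1 (cong not (sym w-0))
  w-complement zero    {suc _} (s<s ())
  w-complement (suc e) {i} i<B^e with divMod-view B i
  ... | q , r , r<B , refl = begin
    w (B * B ^ e + (B * q + r)) ≡⟨ cong w (solve 4 (λ b x q r → b :* x :+ (b :* q :+ r) := b :* (x :+ q) :+ r)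
                                                   refl B (B ^ e) q r) ⟩
    w (B * (B ^ e + q) + r)     ≡⟨ w-morphic (B ^ e + q) r<B ⟩
    w (B ^ e + q) xor odd r     ≡⟨ cong (_xor odd r) (w-complement e q<B^e) ⟩
    not (w q) xor odd r         ≡⟨ not-distribˡ-xor (w q) (odd r) ⟨
    not (w q xor odd r)         ≡⟨ cong not (w-morphic q r<B) ⟨
    not (w (B * q + r))         ∎
    where
    q<B^e : q < B ^ e
    q<B^e = *-cancelˡ-< B q (B ^ e) (≤-<-trans (m≤m+n (B * q) r) i<B^e)

  y-periodic : ∀ e {j} → suc j < B ^ e → y (B ^ e + j) ≡ y j
  y-periodic e {j} j+1<B^e = begin
    not (w (B ^ e + j) xor w (suc (B ^ e + j))) ≡⟨ cong (λ i → not (w (B ^ e + j) xor w i))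
                                                         (sym (+-suc (B ^ e) j)) ⟩
    not (w (B ^ e + j) xor w (B ^ e + suc j))   ≡⟨ cong₂ (λ u v → not (u xor v))
                                                         (w-complement e (<-trans (n<1+n j) j+1<B^e))
                                                         (w-complement e j+1<B^e) ⟩
    not (not (w j) xor not (w (suc j)))         ≡⟨ cong not (xor-annihilates-not (w j) (w (suc j))) ⟩
    y j                                         ∎

  complementAt : ℕ → ℕ → ℕ
  complementAt k p = B ^ suc (p + k) + p

  w-complementAt : ∀ k p → w (complementAt k p) ≡ not (w p)
  w-complementAt k p =
    w-complement (suc (p + k)) (≤-<-trans (m≤n⇒m≤1+n (m≤m+n p k)) (n<m^n (s<s 0<B₁) (suc (p + k))))

  agree-complementAt : ∀ k p → Agree k (complementAt k p) p
  agree-complementAt k p {x} x<k = trans (cong y (+-assoc (B ^ suc (p + k)) p x))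
    (y-periodic (suc (p + k)) (<-trans (s≤s (subst (_≤ p + k) (+-suc p x) (+-monoʳ-≤ p x<k)))
                                       (n<m^n (s<s 0<B₁) (suc (p + k)))))

  factor-agree : ∀ {k p p'} → factorAt w p (suc k) ≡ factorAt w p' (suc k) → w p ≡ w p' × Agree k p p'
  factor-agree {k} {p} {p'} eq =
    subst₂ (λ u v → w u ≡ w v) (+-identityʳ p) (+-identityʳ p') (same z<s) ,
    λ {x} x<k → cong₂ (λ u v → not (u xor v)) (same (m<n⇒m<1+n x<k))
                       (subst₂ (λ u v → w u ≡ w v) (+-suc p x) (+-suc p' x) (same (s<s x<k)))
    where
    same : ∀ {x} → x < suc k → w (p + x) ≡ w (p' + x)
    same = applyUpTo-injective {f = λ x → w (p + x)} {g = λ x → w (p' + x)} (suc k)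
             (trans (sym (map-upTo _ (suc k))) (trans eq (map-upTo _ (suc k))))

  agree-factor : ∀ {k p p'} → w p ≡ w p' → Agree k p p' → factorAt w p (suc k) ≡ factorAt w p' (suc k)
  agree-factor {k} {p} {p'} w-eq agree =
    trans (map-upTo _ (suc k))
          (trans (applyUpTo-cong {f = λ x → w (p + x)} {g = λ x → w (p' + x)} (suc k) same) (sym (map-upTo _ (suc k))))
    where
    same : ∀ {x} → x < suc k → w (p + x) ≡ w (p' + x)
    same {zero}  _         = subst₂ (λ u v → w u ≡ w v) (sym (+-identityʳ p)) (sym (+-identityʳ p')) w-eq
    same {suc x} (s<s x<k) = subst₂ (λ u v → w u ≡ w v) (sym (+-suc p x)) (sym (+-suc p' x))
      (trans (w-suc (p + x)) (trans (cong₂ (λ u v → u xor not v) (same (m<n⇒m<1+n x<k)) (agree x<k))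
                                    (sym (w-suc (p' + x)))))

  factors : ℕ → List ℕ → List (List Bool)
  factors k S = map (λ p → factorAt w p (suc k)) (S ++ map (complementAt k) S)

  length-factors : ∀ k S → length (factors k S) ≡ 2 * length S
  length-factors k S = begin
    length (factors k S)                       ≡⟨ length-map _ (S ++ map (complementAt k) S) ⟩
    length (S ++ map (complementAt k) S)       ≡⟨ length-++ S ⟩
    length S + length (map (complementAt k) S) ≡⟨ cong (length S +_) (length-map (complementAt k) S) ⟩
    length S + length S                        ≡⟨ cong (length S +_) (+-identityʳ (length S)) ⟨
    2 * length S                               ∎

  factors-distinct : ∀ {k S} → AllPairs (Distinct k) S → AllPairs _≢_ (factors k S)
  factors-distinct {k} {S} distinct = AllPairs.map⁺ (AllPairs.++⁺
    (AllPairs.map (λ ¬agree eq → ¬agree (proj₂ (factor-agree eq))) distinct)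
    (AllPairs.map⁺ (AllPairs.map complements-distinct distinct))
    (All.tabulate λ a∈ → All.tabulate λ b∈ → case ∈-map⁻ _ b∈ of λ where
      (b , b∈S , refl) → complement-apart a∈ b∈S))
    where
    factor : ℕ → List Bool
    factor p = factorAt w p (suc k)
    complements-distinct : ∀ {a b} → Distinct k a b → factor (complementAt k a) ≢ factor (complementAt k b)
    complements-distinct ¬agree eq = ¬agree (agree-trans (agree-sym (agree-complementAt k _))
                                             (agree-trans (proj₂ (factor-agree eq)) (agree-complementAt k _)))
    complement-apart : ∀ {a b} → a ∈ S → b ∈ S → factor a ≢ factor (complementAt k b)
    complement-apart {a} {b} a∈ b∈ eq with factor-agree eq
    ... | w-eq , agree
      with AllPairs-¬-unique {R = Agree k} agree-sym distinct a∈ b∈ (agree-trans agree (agree-complementAt k b))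
    ...   | refl = not-¬ refl (trans w-eq (w-complementAt k a))

  factors-complete : ∀ {k S} → Representatives k (λ _ → ⊤) S → ∀ i → factorAt w i (suc k) ∈ factors k S
  factors-complete {k} {S} R i with Representatives.complete R i tt
  ... | p , p∈ , agree with w i ≟ w p
  ...   | yes w-eq = subst (_∈ factors k S) (sym (agree-factor w-eq agree)) (∈-map⁺ _ (∈-++⁺ˡ p∈))
  ...   | no  w≢   = subst (_∈ factors k S)
                       (sym (agree-factor (trans (¬-not w≢) (sym (w-complementAt k p)))
                                          (agree-trans agree (agree-sym (agree-complementAt k p)))))
                       (∈-map⁺ _ (∈-++⁺ʳ S (∈-map⁺ (complementAt k) p∈)))

  window-complexity : ∀ {k c} → WindowCount k c → Complexity w (suc k) (2 * c)
  window-complexity {k} (S , R , refl) =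
    factors k S , factors-distinct (Representatives.distinct R) , length-factors k S ,
    occurring , factors-complete R
    where
    occurring : ∀ u → u ∈ factors k S → ∃ λ i → factorAt w i (suc k) ≡ u
    occurring u u∈ with ∈-map⁻ _ u∈
    ... | p , _ , refl = p , refl

  complexity-initial : ∀ n → 1 ≤ n → n ≤ B + 1 → Complexity w n (2 * n)
  complexity-initial (suc k) _ k+1≤B+1 = window-complexity (count-initial (1+n≤m+1⇒n≤m k k+1≤B+1))

  2BY∸Y : ∀ Y → 2 * (B * Y) ∸ Y ≡ B * Y + B₁ * Y
  2BY∸Y Y = trans (cong (_∸ Y) (solve 2 (λ b₁ y → con 2 :* (y :+ b₁ :* y) := y :+ (y :+ b₁ :* y :+ b₁ :* y))
                                        refl B₁ Y))
                  (m+n∸m≡n Y (B * Y + B₁ * Y))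

  complexity-rising : ∀ i n → B ^ suc i + 2 ≤ n → n ≤ 2 * B ^ suc i ∸ B ^ i + 1 →
                      Complexity w n (4 * n ∸ 2 * (B ^ suc i ∸ B ^ i + 2))
  complexity-rising i n lo≤n n≤hi with m+2≤n⇒∃[d]n≡1+m+d lo≤n
  ... | d , refl = subst (Complexity w (suc (B * Y + d))) count (window-complexity (Affine.count (proj₁ (levels i)) d
                     (subst (B * Y + d ≤_) (2BY∸Y Y) (1+n≤m+1⇒n≤m (B * Y + d) n≤hi))))
    where
    Y = B ^ i
    count : 2 * (B * Y + Y + 2 * d) ≡ 4 * suc (B * Y + d) ∸ 2 * (B * Y ∸ Y + 2)
    count = sym (begin
      4 * suc (B * Y + d) ∸ 2 * (B * Y ∸ Y + 2)
        ≡⟨ cong (λ z → 4 * suc (B * Y + d) ∸ 2 * (z + 2)) (m+n∸m≡n Y (B₁ * Y)) ⟩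
      4 * suc (B * Y + d) ∸ 2 * (B₁ * Y + 2)
        ≡⟨ cong (_∸ 2 * (B₁ * Y + 2))
                (solve 3 (λ b₁ y d → con 4 :* (con 1 :+ (y :+ b₁ :* y :+ d))
                                     := con 2 :* (y :+ b₁ :* y :+ y :+ con 2 :* d) :+ con 2 :* (b₁ :* y :+ con 2))
                         refl B₁ Y d) ⟩
      2 * (B * Y + Y + 2 * d) + 2 * (B₁ * Y + 2) ∸ 2 * (B₁ * Y + 2)
        ≡⟨ m+n∸n≡m (2 * (B * Y + Y + 2 * d)) (2 * (B₁ * Y + 2)) ⟩
      2 * (B * Y + Y + 2 * d) ∎)

  complexity-steady : ∀ i n → 2 * B ^ suc i ∸ B ^ i + 2 ≤ n → n ≤ B ^ (suc i + 1) + 1 →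
                      Complexity w n (2 * n + 2 * (B ^ suc i ∸ 1))
  complexity-steady i n lo≤n n≤hi with m+2≤n⇒∃[d]n≡1+m+d (subst (λ m → m + 2 ≤ n) (2BY∸Y (B ^ i)) lo≤n)
  ... | d , refl = subst (Complexity w (suc (lo + d))) count (window-complexity (Affine.count (proj₂ (levels i)) d
                     (subst (lo + d ≤_) (cong (B ^_) (+-comm (suc i) 1)) (1+n≤m+1⇒n≤m (lo + d) n≤hi))))
    where
    X = B ^ suc i
    lo = X + B₁ * B ^ i
    count : 2 * (lo + X + 1 * d) ≡ 2 * suc (lo + d) + 2 * (X ∸ 1)
    count = begin
      2 * (lo + X + 1 * d)           ≡⟨ cong (λ x → 2 * (lo + x + 1 * d)) (sym (m∸n+n≡m (m^n>0 B (suc i)))) ⟩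
      2 * (lo + (X ∸ 1 + 1) + 1 * d) ≡⟨ solve 3 (λ l z d → con 2 :* (l :+ (z :+ con 1) :+ con 1 :* d)
                                                          := con 2 :* (con 1 :+ (l :+ d)) :+ con 2 :* z)
                                                refl lo (X ∸ 1) d ⟩
      2 * suc (lo + d) + 2 * (X ∸ 1) ∎

  complexity-formulas : ComplexityFormulas w B
  complexity-formulas = complexity-initial , λ { (suc i) _ → complexity-rising i , complexity-steady i }

theorem47 : (K : ℕ) → 1 ≤ K →
    let m = 2 ^ K ∸ 1
        B = 2 ^ (2 ^ K)
    in ((n : ℕ) → 1 ≤ n → n ≤ B + 1 → Complexity (a m) n (2 * n))
     × ((j : ℕ) → 1 ≤ j →
          ((n : ℕ) → B ^ j + 2 ≤ n → n ≤ 2 * B ^ j ∸ B ^ (j ∸ 1) + 1 →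
             Complexity (a m) n (4 * n ∸ 2 * (B ^ j ∸ B ^ (j ∸ 1) + 2)))
        × ((n : ℕ) → 2 * B ^ j ∸ B ^ (j ∸ 1) + 2 ≤ n → n ≤ B ^ (j + 1) + 1 →
             Complexity (a m) n (2 * n + 2 * (B ^ j ∸ 1))))
theorem47 K 1≤K =
  subst (ComplexityFormulas (a m)) B₁+1≡B
        (MorphicWord.complexity-formulas B₁ 2≤B₁ (odd-2^∸1 (2 ^ K) (m^n>0 2 K)) (a m) (a-zero m) morphic)
  where
  m = 2 ^ K ∸ 1
  B₁ = 2 ^ 2 ^ K ∸ 1
  B₁+1≡B : suc B₁ ≡ 2 ^ 2 ^ K
  B₁+1≡B = m+[n∸m]≡n (m^n>0 2 (2 ^ K))
  2≤B₁ : 2 ≤ B₁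
  2≤B₁ = ≤-trans (n≤1+n 2) (∸-monoˡ-≤ 1 (^-monoʳ-≤ 2 (^-monoʳ-≤ 2 1≤K)))
  morphic : ∀ q {r} → r < suc B₁ → a m (suc B₁ * q + r) ≡ a m q xor odd r
  morphic = subst (λ B → ∀ q {r} → r < B → a m (B * q + r) ≡ a m q xor odd r) (sym B₁+1≡B) (a-morphic K)
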